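{- Let $M\in\mathbb{N}$, real numbers $p_1<\cdots<p_{M+1}$, $c_1,\ldots,c_{M+1}$ be given, and $\Omega=\{1,\ldots,M+1\}$. For each $n\in\{1,\ldots,M\}$ and each $I\subset\Omega$ with $|I|=n$ there exist real numbers $t^{(n+1)}_0,\ldots,t^{(M)}_0$ such that the line $\{\mathbf{t}_I(\lambda,t^{(n+1)}_0,\ldots,t^{(M)}_0):\lambda\in\mathbb{R}\}$ contains a visible point.
   Context: On $\mathbb{R}^M$ with coordinates $\mathbf{t}=(t^{(1)},\ldots,t^{(M)})$ define $\theta_i(\mathbf{t})=\sum_{r=1}^M p_i^r t^{(r)}+c_i$, $i\in\Omega$. For nonempty $J\subset\Omega$ let $\mathcal{P}_J=\{\mathbf{t}:\theta_i(\mathbf{t})=\theta_j(\mathbf{t})\ \forall i,j\in J\}$ and $\mathcal{U}_J=\{\mathbf{t}:\theta_i(\mathbf{t})=\max_{j\in\Omega}\theta_j(\mathbf{t})\ \forall i\in J\}$. For $|J|=m$, the linear system $t^{(0)}+\sum_{r=1}^{m-1}p_i^r t^{(r)}=-c_i-\sum_{r=m}^M p_i^r t^{(r)}$, $i\in J$, uniquely determines $t^{(0)},\ldots,t^{(m-1)}$ as affine functions $t^{(k)}_J(t^{(m)},\ldots,t^{(M)})$; set $\mathbf{t}_J(t^{(m)},\ldots,t^{(M)})=(t^{(1)}_J,\ldots,t^{(m-1)}_J,t^{(m)},\ldots,t^{(M)})\in\mathcal{P}_J$. A point $\mathbf{t}\in\mathcal{P}_J$ is visible if $\mathbf{t}\in\mathcal{U}_J$.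 -}

module Defs where

open import Level using (0ℓ)
open import Data.Nat using (ℕ; zero; suc; _∸_; _≟_) renaming (_≤_ to _≤ℕ_; _<_ to _<ℕ_)
open import Data.Fin using (Fin) renaming (_<_ to _<F_)
open import Data.Fin.Subset using (Subset; _∈_)
open import Data.Product using (Σ; ∃; _×_; _,_)
open import Data.Sum using (_⊎_)
open import Relation.Binary.PropositionalEquality using (_≡_; _≢_)
open import Relation.Binary.Core using (Rel)
open import Relation.Binary.Structures using (IsStrictTotalOrder)
open import Algebra.Structures using (IsCommutativeRing)
open import Relation.Nullary using (yes; no)

-- An axiomatisation of the real numbers: a complete ordered field.
-- (Any model is isomorphic to ℝ; the theorem is quantified over all
-- models, so it is a statement about ℝ.)

record RealField : Set₁ where
  infixl 7 _*_
  infixl 6 _+_ _-_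
  infix  8 -_
  infix  4 _<_ _≤_
  field
    Carrier : Set
    _+_ _*_ : Carrier → Carrier → Carrier
    -_      : Carrier → Carrier
    0# 1#   : Carrier
    isCommutativeRing : IsCommutativeRing _≡_ _+_ _*_ -_ 0# 1#
    0≢1     : 0# ≢ 1#
    *-inverse : ∀ x → x ≢ 0# → ∃ λ y → x * y ≡ 1#
    _<_     : Rel Carrier 0ℓ
    <-isStrictTotalOrder : IsStrictTotalOrder _≡_ _<_
    +-monoˡ-< : ∀ {x y} z → x < y → x + z < y + z
    *-pos     : ∀ {x y} → 0# < x → 0# < y → 0# < x * y

  _≤_ : Carrier → Carrier → Set
  x ≤ y = x < y ⊎ x ≡ y

  _-_ : Carrier → Carrier → Carrier
  x - y = x + (- y)

  IsUpperBound : (Carrier → Set) → Carrier → Set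
  IsUpperBound S b = ∀ x → S x → x ≤ b

  field
    sup : ∀ (S : Carrier → Set) → (∃ λ x → S x) → (∃ λ b → IsUpperBound S b) →
          ∃ λ s → IsUpperBound S s × (∀ b → IsUpperBound S b → s ≤ b)

  infixr 8 _^_
  _^_ : Carrier → ℕ → Carrier
  x ^ zero  = 1#
  x ^ suc k = x * (x ^ k)

  -- sumRange a b g = g a + g (a+1) + ... + g b   (0 if b < a)
  sumFrom : ℕ → ℕ → (ℕ → Carrier) → Carrier
  sumFrom a zero    g = 0#
  sumFrom a (suc l) g = g a + sumFrom (suc a) l g

  sumRange : ℕ → ℕ → (ℕ → Carrier) → Carrier
  sumRange a b g = sumFrom a (suc b ∸ a) g

-- The setting of the paper.  Ω = Fin (suc M) (index i ∈ Ω stands for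
-- i+1 ∈ {1,…,M+1}).  A point 𝐭 ∈ ℝ^M is a function t : ℕ → ℝ of which
-- only the values t 1, …, t M (= t^(1),…,t^(M)) are used.

module Setting (ℝ : RealField) (M : ℕ) (p c : Fin (suc M) → RealField.Carrier ℝ) where
  open RealField ℝ

  Point : Set
  Point = ℕ → Carrier

  θ : Fin (suc M) → Point → Carrier
  θ i t = sumRange 1 M (λ r → p i ^ r * t r) + c i

  IsMax : Carrier → (Fin (suc M) → Carrier) → Set
  IsMax x f = (∃ λ j → f j ≡ x) × (∀ j → f j ≤ x)

  InP : Subset (suc M) → Point → Set
  InP J t = ∀ i j → i ∈ J → j ∈ J → θ i t ≡ θ j t

  InU : Subset (suc M) → Point → Set
  InU J t = ∀ i → i ∈ J → IsMax (θ i t) (λ j → θ j t)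

  -- t is the point 𝐭_J(s^(m),…,s^(M)) for |J| = m:  its coordinates
  -- m,…,M are the given ones, and together with some t^(0) its
  -- coordinates 1,…,m-1 solve the linear system
  --   t^(0) + Σ_{r=1}^{m-1} p_i^r t^(r) = -c_i - Σ_{r=m}^M p_i^r t^(r),  i ∈ J.
  -- (The paper notes this system has a unique solution, so this
  -- relation characterises the single point 𝐭_J(s).)
  IsTJ : Subset (suc M) → ℕ → Point → Point → Set
  IsTJ J m s t =
    (∀ k → m ≤ℕ k → k ≤ℕ M → t k ≡ s k) ×
    (∃ λ t⁰ → ∀ i → i ∈ J →
       t⁰ + sumRange 1 (m ∸ 1) (λ r → p i ^ r * t r)
         ≡ - c i - sumRange m M (λ r → p i ^ r * t r))

  Visible : Subset (suc M) → Point → Set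
  Visible J t = InP J t × InU J t

  -- the arguments (λ, t₀^(n+1), …, t₀^(M)) of 𝐭_I(λ, t₀^(n+1), …, t₀^(M)),
  -- as a function of the coordinate index k ∈ {n,…,M}
  lineArg : ℕ → Carrier → Point → Point
  lineArg n lam t₀ k with k ≟ n
  ... | yes _ = lam
  ... | no  _ = t₀ k

module Submission where

-- Idea: θ_j(𝐭) + t^(0) is the value at p_j of the polynomial with
-- coefficients (t^(0), t^(1), …, t^(M)).  Since the nodes p_1 < ⋯ < p_{M+1}
-- are distinct, Newton interpolation gives a polynomial q of degree ≤ M with
-- q(p_j) = -c_j - δ_j, where the penalty δ_j is 0 for j ∈ I and 1 otherwise.
-- Taking t^(r) = (r-th coefficient of q) yields θ_j(𝐭) = -q₀ - δ_j: constant
-- on I and strictly smaller off I, so 𝐭 ∈ 𝒫_I ∩ 𝒰_I.  Finally, any point on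
-- which θ is constant over J is 𝐭_J of its own trailing coordinates.

open import Defs
open import Data.Nat using (ℕ; suc; _≤_)
open import Data.Fin using (Fin) renaming (_<_ to _<F_)
open import Data.Fin.Subset using (Subset; ∣_∣)
open import Data.Product using (∃; _×_)
open import Relation.Binary.PropositionalEquality using (_≡_)

open import Level using (0ℓ)
open import Algebra.Bundles using (CommutativeRing)
open import Data.Nat using (zero; _∸_; _≟_; s≤s; z≤n) renaming (_+_ to _+ℕ_)
open import Data.Nat.Properties using (m+[n∸m]≡n; ≤-trans; n≤1+n) renaming (+-identityʳ to ℕ+-identityʳ; +-suc to ℕ+-suc)
open import Data.Fin using (zero; suc)
open import Data.Fin.Subset using (_∈_)
open import Data.Vec using (Vec; []; _∷_; lookup)
open import Data.Vec.Properties using ([]=⇒lookup)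
open import Data.Bool using (Bool; true; false)
open import Data.Product using (Σ; _,_; proj₁; proj₂)
open import Data.Sum using (inj₁; inj₂)
open import Data.Empty using (⊥-elim)
open import Relation.Nullary using (yes; no)
open import Relation.Binary.Definitions using (tri<; tri≈; tri>)
open import Relation.Binary.Structures using (IsStrictTotalOrder)
open import Relation.Binary.PropositionalEquality using (_≢_; refl; sym; trans; cong; cong₂; subst; subst₂; module ≡-Reasoning)

module Reals (ℝ : RealField) where
  open RealField ℝ renaming (_<_ to _<ℝ_; _≤_ to _≤ℝ_)
  open IsStrictTotalOrder <-isStrictTotalOrder using (compare; irrefl) renaming (trans to <-trans)
  open ≡-Reasoning

  commutativeRing : CommutativeRing 0ℓ 0ℓ
  commutativeRing = record { isCommutativeRing = isCommutativeRing }

  open CommutativeRing commutativeRing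
    using (+-assoc; +-comm; +-identityˡ; +-identityʳ; -‿inverseʳ; *-assoc; *-identityˡ; *-identityʳ;
           distribˡ; distribʳ; zeroˡ; zeroʳ; ring; +-abelianGroup; *-commutativeSemigroup)
  open import Algebra.Properties.AbelianGroup +-abelianGroup
    using (\\-leftDividesˡ; \\-leftDividesʳ; //-rightDividesˡ; ⁻¹-anti-homo-∙; ⁻¹-involutive)
  open import Algebra.Properties.Ring ring using (-‿distribˡ-*; -1*x≈-x)
  open import Algebra.Properties.CommutativeSemigroup *-commutativeSemigroup using (x∙yz≈y∙xz)

  sumFrom-cong : ∀ a l {g h : ℕ → Carrier} → (∀ r → g r ≡ h r) → sumFrom a l g ≡ sumFrom a l h
  sumFrom-cong a zero    g≗h = refl
  sumFrom-cong a (suc l) g≗h = cong₂ _+_ (g≗h a) (sumFrom-cong (suc a) l g≗h)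

  sumFrom-shift : ∀ a l (g : ℕ → Carrier) → sumFrom (suc a) l g ≡ sumFrom a l (λ r → g (suc r))
  sumFrom-shift a zero    g = refl
  sumFrom-shift a (suc l) g = cong (g (suc a) +_) (sumFrom-shift (suc a) l g)

  sumFrom-*ˡ : ∀ x a l (g : ℕ → Carrier) → x * sumFrom a l g ≡ sumFrom a l (λ r → x * g r)
  sumFrom-*ˡ x a zero    g = zeroʳ x
  sumFrom-*ˡ x a (suc l) g = trans (distribˡ x (g a) _) (cong (x * g a +_) (sumFrom-*ˡ x (suc a) l g))

  sumFrom-split : ∀ a l₁ l₂ (g : ℕ → Carrier) →
                  sumFrom a (l₁ +ℕ l₂) g ≡ sumFrom a l₁ g + sumFrom (a +ℕ l₁) l₂ g
  sumFrom-split a zero l₂ g = begin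
    sumFrom a l₂ g              ≡⟨ cong (λ b → sumFrom b l₂ g) (sym (ℕ+-identityʳ a)) ⟩
    sumFrom (a +ℕ 0) l₂ g       ≡⟨ sym (+-identityˡ _) ⟩
    0# + sumFrom (a +ℕ 0) l₂ g  ∎
  sumFrom-split a (suc l₁) l₂ g = begin
    g a + sumFrom (suc a) (l₁ +ℕ l₂) g
      ≡⟨ cong (g a +_) (sumFrom-split (suc a) l₁ l₂ g) ⟩
    g a + (sumFrom (suc a) l₁ g + sumFrom (suc a +ℕ l₁) l₂ g)
      ≡⟨ cong (λ b → g a + (sumFrom (suc a) l₁ g + sumFrom b l₂ g)) (sym (ℕ+-suc a l₁)) ⟩
    g a + (sumFrom (suc a) l₁ g + sumFrom (a +ℕ suc l₁) l₂ g)
      ≡⟨ sym (+-assoc _ _ _) ⟩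
    (g a + sumFrom (suc a) l₁ g) + sumFrom (a +ℕ suc l₁) l₂ g ∎

  -- Polynomials of degree < k, stored by their coefficient vector.

  eval : ∀ {k} → Vec Carrier k → Carrier → Carrier
  eval []       x = 0#
  eval (a ∷ as) x = a + x * eval as x

  coef : ∀ {k} → Vec Carrier k → ℕ → Carrier
  coef []       r       = 0#
  coef (a ∷ as) zero    = a
  coef (a ∷ as) (suc r) = coef as r

  eval-as-sum : ∀ {k} (as : Vec Carrier k) x → eval as x ≡ sumFrom 0 k (λ r → x ^ r * coef as r)
  eval-as-sum []                 x = refl
  eval-as-sum {suc k} (a ∷ as) x = begin
    a + x * eval as x
      ≡⟨ cong (λ e → a + x * e) (eval-as-sum as x) ⟩
    a + x * sumFrom 0 k (λ r → x ^ r * coef as r)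
      ≡⟨ cong (a +_) (sumFrom-*ˡ x 0 k _) ⟩
    a + sumFrom 0 k (λ r → x * (x ^ r * coef as r))
      ≡⟨ cong (a +_) (sumFrom-cong 0 k (λ r → sym (*-assoc x (x ^ r) (coef as r)))) ⟩
    a + sumFrom 0 k (λ r → x ^ suc r * coef as r)
      ≡⟨ cong₂ _+_ (sym (*-identityˡ a)) (sym (sumFrom-shift 0 k (λ r → x ^ r * coef (a ∷ as) r))) ⟩
    1# * a + sumFrom 1 k (λ r → x ^ r * coef (a ∷ as) r) ∎

  -- Newton step: the coefficients of c + (X - b)·q
  newtonStep : ∀ {k} → Carrier → Carrier → Vec Carrier k → Vec Carrier (suc k)
  newtonStep c b []       = c ∷ []
  newtonStep c b (q ∷ qs) = (c - b * q) ∷ newtonStep q b qs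

  eval-newtonStep : ∀ {k} c b (qs : Vec Carrier k) x → eval (newtonStep c b qs) x ≡ c + (x - b) * eval qs x
  eval-newtonStep c b [] x = cong (c +_) (trans (zeroʳ x) (sym (zeroʳ (x - b))))
  eval-newtonStep c b (q ∷ qs) x = begin
    (c - b * q) + x * eval (newtonStep q b qs) x
      ≡⟨ cong (λ e → (c - b * q) + x * e) (eval-newtonStep q b qs x) ⟩
    (c - b * q) + x * (q + (x - b) * E)
      ≡⟨ cong ((c - b * q) +_) (trans (distribˡ x q _) (cong (x * q +_) (x∙yz≈y∙xz x (x - b) E))) ⟩
    (c + - (b * q)) + (x * q + Z)
      ≡⟨ +-assoc c _ _ ⟩
    c + (- (b * q) + (x * q + Z))
      ≡⟨ cong (c +_) (trans (sym (+-assoc _ _ _)) (cong (_+ Z) (+-comm _ _))) ⟩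
    c + ((x * q + - (b * q)) + Z)
      ≡⟨ cong (λ e → c + ((x * q + e) + Z)) (-‿distribˡ-* b q) ⟩
    c + ((x * q + - b * q) + Z)
      ≡⟨ cong (c +_) (trans (cong (_+ Z) (sym (distribʳ q x (- b)))) (sym (distribˡ (x - b) q (x * E)))) ⟩
    c + (x - b) * (q + x * E) ∎
    where
      E = eval qs x
      Z = (x - b) * (x * E)

  x-y≢0 : ∀ {x y} → x ≢ y → x - y ≢ 0#
  x-y≢0 {x} {y} x≢y x-y≡0 = x≢y (begin
    x             ≡⟨ sym (//-rightDividesˡ y x) ⟩
    (x - y) + y   ≡⟨ cong (_+ y) x-y≡0 ⟩
    0# + y        ≡⟨ +-identityˡ y ⟩
    y             ∎)

  inverse : ∀ x → x ≢ 0# → Carrier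
  inverse x x≢0 = proj₁ (*-inverse x x≢0)

  Distinct : ∀ {k} → (Fin k → Carrier) → Set
  Distinct x = ∀ i j → i <F j → x i ≢ x j

  interpolate : ∀ k (x y : Fin k → Carrier) → Distinct x →
                Σ (Vec Carrier k) λ as → ∀ j → eval as (x j) ≡ y j
  interpolate zero    x y distinct = [] , λ ()
  interpolate (suc k) x y distinct = newtonStep (y zero) (x zero) q , fits
    where
      gap≢0 : ∀ j → x (suc j) - x zero ≢ 0#
      gap≢0 j = x-y≢0 (λ e → distinct zero (suc j) (s≤s z≤n) (sym e))
      divided : Fin k → Carrier
      divided j = (y (suc j) - y zero) * inverse _ (gap≢0 j)
      rest = interpolate k (λ j → x (suc j)) divided (λ i j i<j → distinct (suc i) (suc j) (s≤s i<j))
      q = proj₁ rest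
      fits : ∀ j → eval (newtonStep (y zero) (x zero) q) (x j) ≡ y j
      fits zero = begin
        eval (newtonStep (y zero) (x zero) q) (x zero)  ≡⟨ eval-newtonStep _ _ q _ ⟩
        y zero + (x zero - x zero) * eval q (x zero)    ≡⟨ cong (λ e → y zero + e * eval q (x zero)) (-‿inverseʳ _) ⟩
        y zero + 0# * eval q (x zero)                   ≡⟨ cong (y zero +_) (zeroˡ _) ⟩
        y zero + 0#                                     ≡⟨ +-identityʳ _ ⟩
        y zero                                          ∎
      fits (suc j) = begin
        eval (newtonStep (y zero) (x zero) q) (x (suc j))  ≡⟨ eval-newtonStep _ _ q _ ⟩
        y zero + gap * eval q (x (suc j))                  ≡⟨ cong (λ e → y zero + gap * e) (proj₂ rest j) ⟩
        y zero + gap * ((y (suc j) - y zero) * w)          ≡⟨ cong (y zero +_) (x∙yz≈y∙xz gap _ w) ⟩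
        y zero + (y (suc j) - y zero) * (gap * w)          ≡⟨ cong (λ e → y zero + (y (suc j) - y zero) * e)
                                                                   (proj₂ (*-inverse _ (gap≢0 j))) ⟩
        y zero + (y (suc j) - y zero) * 1#                 ≡⟨ cong (y zero +_) (*-identityʳ _) ⟩
        y zero + (y (suc j) - y zero)                      ≡⟨ +-comm _ _ ⟩
        (y (suc j) - y zero) + y zero                      ≡⟨ //-rightDividesˡ (y zero) (y (suc j)) ⟩
        y (suc j)                                          ∎
        where
          gap = x (suc j) - x zero
          w = inverse gap (gap≢0 j)

  0<1 : 0# <ℝ 1#
  0<1 with compare 0# 1#
  ... | tri< 0<1 _ _ = 0<1
  ... | tri≈ _ 0≡1 _ = ⊥-elim (0≢1 0≡1)
  ... | tri> _ _ 1<0 = ⊥-elim (irrefl refl (<-trans 1<0 (subst (0# <ℝ_) square (*-pos 0<-1 0<-1))))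
    where
      -- adding -1 to 1 < 0 gives 0 < -1, whose square is 1
      0<-1 : 0# <ℝ - 1#
      0<-1 = subst₂ _<ℝ_ (-‿inverseʳ 1#) (+-identityˡ (- 1#)) (+-monoˡ-< (- 1#) 1<0)
      square : - 1# * - 1# ≡ 1#
      square = trans (-1*x≈-x (- 1#)) (⁻¹-involutive 1#)

  neg-antitone : ∀ {d e} → d <ℝ e → - e <ℝ - d
  neg-antitone {d} {e} d<e =
    subst₂ _<ℝ_ (\\-leftDividesˡ d (- e)) (trans (cong (e +_) (+-comm (- d) (- e))) (\\-leftDividesˡ e (- d)))
                (+-monoˡ-< (- d + - e) d<e)

  x-‿antitone : ∀ x {d e} → d ≤ℝ e → x - e ≤ℝ x - d
  x-‿antitone x {d} {e} (inj₁ d<e) = inj₁ (subst₂ _<ℝ_ (+-comm (- e) x) (+-comm (- d) x) (+-monoˡ-< x (neg-antitone d<e)))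
  x-‿antitone x (inj₂ refl) = inj₂ refl

  increasing⇒distinct : ∀ {k} {x : Fin k → Carrier} → (∀ i j → i <F j → x i <ℝ x j) → Distinct x
  increasing⇒distinct increasing i j i<j xi≡xj = irrefl xi≡xj (increasing i j i<j)

  module Geometry (M : ℕ) (p c : Fin (suc M) → Carrier) where
    open Setting ℝ M p c

    -- θ_j evaluated at the coefficients (q₁,…,q_M) of q equals q(p_j) - q₀ + c_j;
    -- in particular q(p_j) = -c_j - d gives θ_j = -q₀ - d.
    θ-at-coefficients : ∀ (as : Vec Carrier (suc M)) j d → eval as (p j) ≡ - c j - d →
                        θ j (coef as) ≡ - coef as 0 - d
    θ-at-coefficients as j d fit = begin
      S + c j                      ≡⟨ cong (_+ c j) (sym (\\-leftDividesʳ a S)) ⟩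
      (- a + (a + S)) + c j        ≡⟨ cong (λ e → (- a + (e + S)) + c j) (sym (*-identityˡ a)) ⟩
      (- a + (1# * a + S)) + c j   ≡⟨ cong (λ e → (- a + e) + c j) (trans (sym (eval-as-sum as (p j))) fit) ⟩
      (- a + (- c j - d)) + c j    ≡⟨ +-assoc (- a) _ _ ⟩
      - a + ((- c j - d) + c j)    ≡⟨ cong (λ e → - a + (e + c j)) (+-comm (- c j) (- d)) ⟩
      - a + ((- d - c j) + c j)    ≡⟨ cong (- a +_) (//-rightDividesˡ (c j) (- d)) ⟩
      - a - d                      ∎
      where
        a = coef as 0
        S = sumFrom 1 M (λ r → p j ^ r * coef as r)

    -- A point on which θ takes a constant value V over J is 𝐭_J of its own
    -- trailing coordinates t^(m),…,t^(M), with t^(0) = -V.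
    level⇒IsTJ : ∀ {J m s t} V → 1 ≤ m → m ≤ M → (∀ k → m ≤ k → k ≤ M → t k ≡ s k) →
                 (∀ i → i ∈ J → θ i t ≡ V) → IsTJ J m s t
    level⇒IsTJ {J} {suc m} {s} {t} V (s≤s z≤n) m<M agree level = agree , - V , system
      where
        system : ∀ i → i ∈ J → - V + sumFrom 1 m (λ r → p i ^ r * t r)
                                ≡ - c i - sumFrom (suc m) (M ∸ m) (λ r → p i ^ r * t r)
        system i i∈J = begin
          - V + A                  ≡⟨ cong (λ v → - v + A) (sym (trans (cong (_+ c i) split) (level i i∈J))) ⟩
          - ((A + B) + c i) + A    ≡⟨ cong (_+ A) (trans (⁻¹-anti-homo-∙ (A + B) (c i))
                                                         (cong (- c i +_) (⁻¹-anti-homo-∙ A B))) ⟩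
          (- c i + (- B + - A)) + A ≡⟨ +-assoc (- c i) _ _ ⟩
          - c i + ((- B + - A) + A) ≡⟨ cong (- c i +_) (//-rightDividesˡ A (- B)) ⟩
          - c i - B                ∎
          where
            g = λ r → p i ^ r * t r
            A = sumFrom 1 m g
            B = sumFrom (suc m) (M ∸ m) g
            split : A + B ≡ sumFrom 1 M g
            split = trans (sym (sumFrom-split 1 m (M ∸ m) g))
                          (cong (λ l → sumFrom 1 l g) (m+[n∸m]≡n (≤-trans (n≤1+n m) m<M)))

    lineArg-self : ∀ n (t : Point) k → lineArg n (t n) t k ≡ t k
    lineArg-self n t k with k ≟ n
    ... | yes k≡n = cong t (sym k≡n)
    ... | no  _   = refl

    module VisiblePoint (distinct : Distinct p) (I : Subset (suc M)) where

      penalty : Bool → Carrier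
      penalty true  = 0#
      penalty false = 1#

      penalty≥0 : ∀ b → 0# ≤ℝ penalty b
      penalty≥0 true  = inj₂ refl
      penalty≥0 false = inj₁ 0<1

      δ : Fin (suc M) → Carrier
      δ j = penalty (lookup I j)

      target : Fin (suc M) → Carrier
      target j = - c j - δ j

      interpolant : Vec Carrier (suc M)
      interpolant = proj₁ (interpolate (suc M) p target distinct)

      t : Point
      t = coef interpolant

      θ-t : ∀ j → θ j t ≡ - t 0 - δ j
      θ-t j = θ-at-coefficients interpolant j (δ j) (proj₂ (interpolate (suc M) p target distinct) j)

      level-on-I : ∀ i → i ∈ I → θ i t ≡ - t 0 - 0#
      level-on-I i i∈I = trans (θ-t i) (cong (λ b → - t 0 - penalty b) ([]=⇒lookup i∈I))

      visible : Visible I t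
      visible = (λ i j i∈I j∈I → trans (level-on-I i i∈I) (sym (level-on-I j j∈I)))
              , λ i i∈I → (i , refl)
                        , λ j → subst₂ _≤ℝ_ (sym (θ-t j)) (sym (level-on-I i i∈I))
                                          (x-‿antitone (- t 0) (penalty≥0 (lookup I j)))

proposition3p13 : (ℝ : RealField) (M : ℕ) (p c : Fin (suc M) → RealField.Carrier ℝ) →
    (∀ i j → i <F j → RealField._<_ ℝ (p i) (p j)) →
    ∀ (n : ℕ) → 1 ≤ n → n ≤ M → ∀ (I : Subset (suc M)) → ∣ I ∣ ≡ n →
    ∃ λ (t₀ : ℕ → RealField.Carrier ℝ) →
      ∃ λ (lam : RealField.Carrier ℝ) → ∃ λ (t : ℕ → RealField.Carrier ℝ) →
        Setting.IsTJ ℝ M p c I n (λ k → Setting.lineArg ℝ M p c n lam t₀ k) t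
          × Setting.Visible ℝ M p c I t
proposition3p13 ℝ M p c increasing n 1≤n n≤M I _ =
  t , t n , t , onLine , visible
  where
    open Reals ℝ
    open Setting ℝ M p c using (IsTJ; lineArg)
    open Geometry M p c
    open VisiblePoint (increasing⇒distinct increasing) I
    onLine : IsTJ I n (λ k → lineArg n (t n) t k) t
    onLine = level⇒IsTJ _ 1≤n n≤M (λ k _ _ → sym (lineArg-self n t k)) level-on-I
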